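{- Let $\mathcal{T}$ be a sensible intersection type theory. Then there exists a non-sensible intersection type theory $\mathcal{T}'$ such that (the gitt induced by) $\mathcal{T}$ is embeddable in (the gitt induced by) $\mathcal{T}'$.
   Context: Intersection types over constants $\mathbb{A}$ and a distinguished ${\sf U}$: $A::={\sf c}\mid{\sf U}\mid A\to A\mid A\cap A$. A subtyping relation $\leq$ is closed under: $A\leq A$; $B\cap A\leq B$; $B\cap A\leq A$; $A\leq{\sf U}$; $B\leq A, B\leq A'\Rightarrow B\leq A\cap A'$; transitivity; and $B'\sim B, A\sim A'\Rightarrow B\to A\sim B'\to A'$ ($\sim$ being the induced equivalence). An itt $\mathcal{T}=\langle\mathbb{A},\leq_{\mathcal{T}}\rangle$ is a set of constants with a subtyping relation. Type assignment for $\mathcal{T}$ derives $\Gamma\vdash M:A$ ($\Gamma$ a finite map from variables to types) by: $\Gamma,x:A\vdash x:A$; $\Gamma\vdash M:{\sf U}$; from $\Gamma,x:B\vdash M:A$ infer $\Gamma\vdash\lambda x.M:B\to A$; from $\Gamma\vdash M:B\to A$ and $\Gamma\vdash N:B$ infer $\Gamma\vdash MN:A$; from $\Gamma\vdash M:B$ and $\Gamma\vdash M:A$ infer $\Gamma\vdash M:B\cap A$; from $\Gamma\vdash M:B$ and $B\leq_{\mathcal{T}}A$ infer $\Gamma\vdash M:A$. A $\lambda$-term is unsolvable if its head reduction is infinite (equivalently, no closing application of it reduces to $\lambda x.x$). $\mathcal{T}$ is sensible if whenever $M$ is unsolvable and $\Gamma\vdash M:A$, then $A\sim_{\mathcal{T}}{\sf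 U}$; otherwise it is non-sensible. The gitt induced by $\mathcal{T}$ is the set of $\sim_{\mathcal{T}}$-classes ordered by $\leq_{\mathcal{T}}$, with top the class of ${\sf U}$, meet induced by $\cap$ and arrow induced by $\to$. A gitt $\langle\Theta,\sqsubseteq_\Theta\rangle$ (meet-semilattice with top $\top_\Theta$, meet $\sqcap_\Theta$, arrow $\rightsquigarrow_\Theta$) is embeddable in $\langle\Theta',\sqsubseteq_{\Theta'}\rangle$ if there is $\kappa:\Theta\to\Theta'$ with: $\kappa(\alpha)=\top_{\Theta'}$ iff $\alpha\equiv_\Theta\top_\Theta$; $\kappa(\alpha\rightsquigarrow_\Theta\beta)=\kappa(\alpha)\rightsquigarrow_{\Theta'}\kappa(\beta)$; $\kappa(\alpha\sqcap_\Theta\beta)=\kappa(\alpha)\sqcap_{\Theta'}\kappa(\beta)$; $\alpha\sqsubseteq_\Theta\beta$ implies $\kappa(\alpha)\sqsubseteq_{\Theta'}\kappa(\beta)$. -}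

module Defs where

open import Data.Nat using (ℕ; zero; suc; pred; _<ᵇ_; _≡ᵇ_)
open import Data.Bool using (if_then_else_)
open import Data.List using (List; []; _∷_)
open import Data.Maybe using (Maybe; just; nothing)
open import Data.Product using (_×_; Σ)
open import Relation.Binary.PropositionalEquality using (_≡_)
open import Relation.Nullary using (¬_)

infixr 7 _⇒_
infixl 8 _∩_

data Ty (𝔸 : Set) : Set where
  con : 𝔸 → Ty 𝔸
  U   : Ty 𝔸
  _⇒_ : Ty 𝔸 → Ty 𝔸 → Ty 𝔸
  _∩_ : Ty 𝔸 → Ty 𝔸 → Ty 𝔸

record ITT : Set₁ where
  field
    Const : Set
    _≤_   : Ty Const → Ty Const → Set

  _∼_ : Ty Const → Ty Const → Set
  A ∼ B = (A ≤ B) × (B ≤ A)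

  field
    ≤-refl  : ∀ {A} → A ≤ A
    ∩-lb₁   : ∀ {A B} → (B ∩ A) ≤ B
    ∩-lb₂   : ∀ {A B} → (B ∩ A) ≤ A
    ≤-U     : ∀ {A} → A ≤ U
    ∩-glb   : ∀ {A A' B} → B ≤ A → B ≤ A' → B ≤ (A ∩ A')
    ≤-trans : ∀ {A B C} → A ≤ B → B ≤ C → A ≤ C
    ⇒-cong  : ∀ {A A' B B'} → B' ∼ B → A ∼ A' → (B ⇒ A) ∼ (B' ⇒ A')

data Term : Set where
  var : ℕ → Term
  lam : Term → Term
  app : Term → Term → Term

shift : ℕ → Term → Term
shift c (var i)   = if i <ᵇ c then var i else var (suc i)
shift c (lam M)   = lam (shift (suc c) M)
shift c (app M N) = app (shift c M) (shift c N)

-- subst j N M : substitute N for index j in M, decrementing indices > j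
subst : ℕ → Term → Term → Term
subst j N (var i)   = if i <ᵇ j then var i else (if i ≡ᵇ j then N else var (pred i))
subst j N (lam M)   = lam (subst (suc j) (shift 0 N) M)
subst j N (app M P) = app (subst j N M) (subst j N P)

data IsApp : Term → Set where
  isApp : ∀ {M N} → IsApp (app M N)

-- one step of head reduction:
-- λx⃗.(λy.M) N N⃗  →  λx⃗.M[N/y] N⃗
data _⟶h_ : Term → Term → Set where
  h-β   : ∀ {M N} → app (lam M) N ⟶h subst 0 N M
  h-lam : ∀ {M M'} → M ⟶h M' → lam M ⟶h lam M'
  h-app : ∀ {M M' N} → IsApp M → M ⟶h M' → app M N ⟶h app M' N

Unsolvable : Term → Set
Unsolvable M = Σ (ℕ → Term) λ f → (f 0 ≡ M) × (∀ i → f i ⟶h f (suc i))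

-- Type assignment for an itt 𝒯.
-- A basis Γ is a finite partial map from (de Bruijn) variables to types:
-- position i holds the type of variable i if i ∈ dom Γ.

module TypeAssignment (𝒯 : ITT) where
  open ITT 𝒯

  Basis : Set
  Basis = List (Maybe (Ty Const))

  lookupB : Basis → ℕ → Maybe (Ty Const)
  lookupB []       _       = nothing
  lookupB (x ∷ Γ)  zero    = x
  lookupB (x ∷ Γ)  (suc i) = lookupB Γ i

  data _⊢_∶_ : Basis → Term → Ty Const → Set where
    ax   : ∀ {Γ i A} → lookupB Γ i ≡ just A → Γ ⊢ var i ∶ A
    ax-U : ∀ {Γ M} → Γ ⊢ M ∶ U
    →I   : ∀ {Γ M A B} → (just B ∷ Γ) ⊢ M ∶ A → Γ ⊢ lam M ∶ (B ⇒ A)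
    →E   : ∀ {Γ M N A B} → Γ ⊢ M ∶ (B ⇒ A) → Γ ⊢ N ∶ B → Γ ⊢ app M N ∶ A
    ∩I   : ∀ {Γ M A B} → Γ ⊢ M ∶ B → Γ ⊢ M ∶ A → Γ ⊢ M ∶ (B ∩ A)
    ≤-rule : ∀ {Γ M A B} → Γ ⊢ M ∶ B → B ≤ A → Γ ⊢ M ∶ A

Sensible : ITT → Set
Sensible 𝒯 = ∀ Γ M A → Unsolvable M → Γ ⊢ M ∶ A → A ∼ U
  where open ITT 𝒯
        open TypeAssignment 𝒯

NonSensible : ITT → Set
NonSensible 𝒯 = ¬ Sensible 𝒯

-- Gitts, presented on representatives: a carrier with an equivalence ≈
-- (elements of the gitt are ≈-classes), order ⊑, top, meet and arrow.

record GittOps : Set₁ where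
  field
    Carrier : Set
    _⊑_     : Carrier → Carrier → Set
    ⊤       : Carrier
    _⊓_     : Carrier → Carrier → Carrier
    _↝_     : Carrier → Carrier → Carrier

  _≈_ : Carrier → Carrier → Set
  a ≈ b = (a ⊑ b) × (b ⊑ a)

inducedGitt : ITT → GittOps
inducedGitt 𝒯 = record
  { Carrier = Ty Const
  ; _⊑_     = _≤_
  ; ⊤       = U
  ; _⊓_     = _∩_
  ; _↝_     = _⇒_
  }
  where open ITT 𝒯

-- Embeddability of gitts. κ is given on representatives and must be
-- well defined on classes (respect ≈).
record Embedding (Θ Θ' : GittOps) : Set where
  private
    module Θ  = GittOps Θ
    module Θ' = GittOps Θ'
  field
    κ       : Θ.Carrier → Θ'.Carrier
    κ-resp  : ∀ {α β} → α Θ.≈ β → κ α Θ'.≈ κ β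
    κ-top   : ∀ {α} → (κ α Θ'.≈ Θ'.⊤ → α Θ.≈ Θ.⊤) × (α Θ.≈ Θ.⊤ → κ α Θ'.≈ Θ'.⊤)
    κ-arrow : ∀ {α β} → κ (α Θ.↝ β) Θ'.≈ (κ α Θ'.↝ κ β)
    κ-meet  : ∀ {α β} → κ (α Θ.⊓ β) Θ'.≈ (κ α Θ'.⊓ κ β)
    κ-mono  : ∀ {α β} → α Θ.⊑ β → κ α Θ'.⊑ κ β

Embeddable : GittOps → GittOps → Set
Embeddable Θ Θ' = Embedding Θ Θ'

{-# OPTIONS --safe #-}
module Submission where

-- Adjoin to 𝒯 a fresh constant ⋆ with ⋆ ∼ ⋆ → ⋆ but ⋆ ≁ U; then the unsolvable
-- Ω = (λx.xx)(λx.xx) gets the type ⋆, so the extension is non-sensible whatever 𝒯 is.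
-- The extended subtyping is read off the interpretation A ↦ (erase A, ends-in-⋆ A) in
-- 𝒯 × 𝟚, with the types ending in ⋆ at the bottom of 𝟚.  Erasing sends ⋆, and every
-- type ending in ⋆, to U, so ⋆ and ⋆ → ⋆ have the same interpretation, while on types
-- of 𝒯 the interpretation is (A, false) and the order of 𝒯 is reflected unchanged.

open import Defs hiding (subst)
open import Data.Bool using (Bool; true; false; T; _∨_; if_then_else_)
open import Data.Bool.Properties using (T-∨)
open import Data.Empty using (⊥-elim)
open import Data.List using ([])
open import Data.Product using (Σ; _×_; _,_; proj₁; proj₂; map)
open import Data.Sum using (_⊎_; inj₁; inj₂; [_,_])
open import Data.Unit using (⊤; tt)
open import Function using (_∘_)
open import Function.Bundles using (Equivalence)
open import Relation.Binary.PropositionalEquality using (_≡_; refl; sym; subst; subst₂)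
open import Relation.Nullary using (¬_)

ω : Term
ω = lam (app (var 0) (var 0))

Ω : Term
Ω = app ω ω

Ω-unsolvable : Unsolvable Ω
Ω-unsolvable = (λ _ → Ω) , refl , λ _ → h-β

module _ (𝒯 : ITT) where
  open ITT 𝒯
  open TypeAssignment 𝒯

  Ω-typable : ∀ {R} → R ∼ (R ⇒ R) → [] ⊢ Ω ∶ R
  Ω-typable {R} (R≤R⇒R , R⇒R≤R) = →E (≤-rule ⊢ω R≤R⇒R) ⊢ω
    where
    ⊢ω : [] ⊢ ω ∶ R
    ⊢ω = ≤-rule (→I (→E (≤-rule (ax refl) R≤R⇒R) (ax refl))) R⇒R≤R

  nonSensible-if-reflexive-type : ∀ {R} → R ∼ (R ⇒ R) → ¬ (U ≤ R) → NonSensible 𝒯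
  nonSensible-if-reflexive-type R∼R⇒R U≰R sensible =
    U≰R (proj₂ (sensible [] Ω _ Ω-unsolvable (Ω-typable R∼R⇒R)))

module WithReflexiveConstant (𝒯 : ITT) where
  open ITT 𝒯

  Const⋆ : Set
  Const⋆ = Const ⊎ ⊤

  ⋆ : Ty Const⋆
  ⋆ = con (inj₂ tt)

  ends-in-⋆ : Ty Const⋆ → Bool
  ends-in-⋆ (con (inj₁ _)) = false
  ends-in-⋆ (con (inj₂ _)) = true
  ends-in-⋆ U              = false
  ends-in-⋆ (A ⇒ B)        = ends-in-⋆ B
  ends-in-⋆ (A ∩ B)        = ends-in-⋆ A ∨ ends-in-⋆ B

  erase : Ty Const⋆ → Ty Const
  erase (con (inj₁ c)) = con c
  erase (con (inj₂ _)) = U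
  erase U              = U
  erase (A ⇒ B)        = if ends-in-⋆ B then U else (erase A ⇒ erase B)
  erase (A ∩ B)        = erase A ∩ erase B

  record _≤⋆_ (A B : Ty Const⋆) : Set where
    constructor _,_
    field
      erase-≤            : erase A ≤ erase B
      ends-in-⋆-antitone : T (ends-in-⋆ B) → T (ends-in-⋆ A)

  ≤⋆-refl : ∀ {A} → A ≤⋆ A
  ≤⋆-refl = ≤-refl , λ p → p

  ≤⋆-trans : ∀ {A B C} → A ≤⋆ B → B ≤⋆ C → A ≤⋆ C
  ≤⋆-trans (A≤B , B→A) (B≤C , C→B) = ≤-trans A≤B B≤C , B→A ∘ C→B

  ∩-glb⋆ : ∀ {A A' C} → C ≤⋆ A → C ≤⋆ A' → C ≤⋆ (A ∩ A')
  ∩-glb⋆ (C≤A , A→C) (C≤A' , A'→C) = ∩-glb C≤A C≤A' , [ A→C , A'→C ] ∘ Equivalence.to T-∨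

  erase-⇒-mono : ∀ {A A' B B'} → erase B' ∼ erase B → erase A ∼ erase A' →
                 (T (ends-in-⋆ A) → T (ends-in-⋆ A')) → (T (ends-in-⋆ A') → T (ends-in-⋆ A)) →
                 erase (B ⇒ A) ≤ erase (B' ⇒ A')
  erase-⇒-mono {A} {A'} B'∼B A∼A' A→A' A'→A with ends-in-⋆ A | ends-in-⋆ A'
  ... | true  | true  = ≤-refl
  ... | false | false = proj₁ (⇒-cong B'∼B A∼A')
  ... | true  | false = ⊥-elim (A→A' tt)
  ... | false | true  = ⊥-elim (A'→A tt)

  ⇒-mono⋆ : ∀ {A A' B B'} → B' ≤⋆ B → B ≤⋆ B' → A ≤⋆ A' → A' ≤⋆ A → (B ⇒ A) ≤⋆ (B' ⇒ A')
  ⇒-mono⋆ {A} {A'} {B} {B'} (B'≤B , _) (B≤B' , _) (A≤A' , A'→A) (A'≤A , A→A') =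
    erase-⇒-mono {A} {A'} {B} {B'} (B'≤B , B≤B') (A≤A' , A'≤A) A→A' A'→A , A'→A

  𝒯⋆ : ITT
  𝒯⋆ = record
    { Const   = Const⋆
    ; _≤_     = _≤⋆_
    ; ≤-refl  = ≤⋆-refl
    ; ∩-lb₁   = ∩-lb₁ , Equivalence.from T-∨ ∘ inj₁
    ; ∩-lb₂   = ∩-lb₂ , Equivalence.from T-∨ ∘ inj₂
    ; ≤-U     = ≤-U , λ ()
    ; ∩-glb   = ∩-glb⋆
    ; ≤-trans = ≤⋆-trans
    ; ⇒-cong  = λ (B'≤B , B≤B') (A≤A' , A'≤A) →
                  ⇒-mono⋆ B'≤B B≤B' A≤A' A'≤A , ⇒-mono⋆ B≤B' B'≤B A'≤A A≤A'
    }

  ⋆∼⋆⇒⋆ : ITT._∼_ 𝒯⋆ ⋆ (⋆ ⇒ ⋆)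
  ⋆∼⋆⇒⋆ = (≤-refl , λ p → p) , (≤-refl , λ p → p)

  U≰⋆ : ¬ (U ≤⋆ ⋆)
  U≰⋆ (_ , ⋆→U) = ⋆→U tt

  𝒯⋆-nonSensible : NonSensible 𝒯⋆
  𝒯⋆-nonSensible = nonSensible-if-reflexive-type 𝒯⋆ ⋆∼⋆⇒⋆ U≰⋆

  inject : Ty Const → Ty Const⋆
  inject (con c) = con (inj₁ c)
  inject U       = U
  inject (A ⇒ B) = inject A ⇒ inject B
  inject (A ∩ B) = inject A ∩ inject B

  ends-in-⋆-inject : ∀ A → ends-in-⋆ (inject A) ≡ false
  ends-in-⋆-inject (con c) = refl
  ends-in-⋆-inject U       = refl
  ends-in-⋆-inject (A ⇒ B) = ends-in-⋆-inject B
  ends-in-⋆-inject (A ∩ B) rewrite ends-in-⋆-inject A | ends-in-⋆-inject B = refl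

  erase-inject : ∀ A → erase (inject A) ≡ A
  erase-inject (con c) = refl
  erase-inject U       = refl
  erase-inject (A ⇒ B) rewrite ends-in-⋆-inject B | erase-inject A | erase-inject B = refl
  erase-inject (A ∩ B) rewrite erase-inject A | erase-inject B = refl

  inject-mono : ∀ {A B} → A ≤ B → inject A ≤⋆ inject B
  inject-mono {A} {B} A≤B =
    subst₂ _≤_ (sym (erase-inject A)) (sym (erase-inject B)) A≤B ,
    ⊥-elim ∘ subst T (ends-in-⋆-inject B)

  inject-reflects : ∀ {A B} → inject A ≤⋆ inject B → A ≤ B
  inject-reflects {A} {B} = subst₂ _≤_ (erase-inject A) (erase-inject B) ∘ _≤⋆_.erase-≤

  inject-embedding : Embedding (inducedGitt 𝒯) (inducedGitt 𝒯⋆)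
  inject-embedding = record
    { κ       = inject
    ; κ-resp  = map inject-mono inject-mono
    ; κ-top   = map inject-reflects inject-reflects , map inject-mono inject-mono
    ; κ-arrow = ≤⋆-refl , ≤⋆-refl
    ; κ-meet  = ≤⋆-refl , ≤⋆-refl
    ; κ-mono  = inject-mono
    }

proposition31 : (𝒯 : ITT) → Sensible 𝒯 →
    Σ ITT (λ 𝒯' → NonSensible 𝒯' × Embeddable (inducedGitt 𝒯) (inducedGitt 𝒯'))
proposition31 𝒯 _ = 𝒯⋆ , 𝒯⋆-nonSensible , inject-embedding
  where open WithReflexiveConstant 𝒯
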